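{- Let $Q$ be a dimer quiver and let $I,J$ be disjoint connected sets of $s>0$ boundary arrows of $Q$, labelled as in the context. Then the quiver $\rho(Q)=\rho_{I,J}(Q)$ is a dimer quiver.
   Context: A dimer quiver is a finite quiver $Q=(Q_0,Q_1)$ with a set of faces $Q_2=Q_2^+\sqcup Q_2^-$, each face $F$ having an oriented boundary cycle $\partial F$, such that: $Q$ has no loops; every arrow lies on the boundary of one face (boundary arrow) or two faces, one in $Q_2^+$ and one in $Q_2^-$ (internal arrow); and at each vertex $i$ the incidence graph (vertices: arrows incident with $i$; edge between $\alpha,\beta$ if $\alpha$ ends at $i$, $\beta$ starts at $i$ and $\alpha\beta$ is a subpath of some face boundary) is non-empty and connected. Gluing the faces gives an oriented surface with boundary. Let $I$ and $J$ be disjoint connected sets of $s>0$ boundary arrows; let $v_0,\dots,v_s$ be the vertices of $I$ labelled clockwise along the boundary and $w_0,\dots,w_s$ the vertices of $J$ labelled anticlockwise, with $v_m\ne w_m$ for $1\le m\le s-1$; $i_m$ is the arrow of $I$ between $v_{m-1}$ and $v_m$ and $j_m$ the arrow of $J$ between $w_{m-1}$ and $w_m$. The arrows $i_m,j_m$ are parallel if either $i_m:v_{m-1}\to v_m$ and $j_m:w_{m-1}\to w_m$, or $i_m:v_m\to v_{m-1}$ and $j_m:w_m\to w_{m-1}$. The quiver $\rho(Q)$ is obtained from $Q$ by, for each $m$ with $i_m,j_m$ not parallel, adding a new arrow $\rho(j_m)$ between the endpoints of $j_m$ in the opposite direction, together with a new face whose boundary is the 2-cycle formed by $j_m$ and $\rho(j_m)$,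 of sign opposite to that of the face containing $j_m$; for parallel $i_m,j_m$ set $\rho(j_m):=j_m$. -}

module Defs where

open import Data.Bool using (Bool; true; false; not; _∧_)
open import Data.Nat using (ℕ; suc; _+_; _<_; _≤_)
open import Data.Fin using (Fin; toℕ; inject₁; _↑ˡ_; _↑ʳ_; splitAt) renaming (suc to fsuc)
open import Data.Fin.Properties using (_≟_)
open import Data.List using (List; []; _∷_; _++_; zip; map; filter; length; lookup; allFin)
open import Data.Nat.ListAction using (sum)
open import Data.Bool.ListAction using (any)
open import Data.List.Membership.Propositional using (_∈_)
open import Data.List.Relation.Unary.All using (All)
open import Data.List.Relation.Unary.Any using (any?)
open import Data.Product using (Σ; _×_; _,_; proj₁; proj₂)
open import Data.Sum using (_⊎_; inj₁; inj₂)
open import Relation.Binary.PropositionalEquality using (_≡_; _≢_)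
open import Relation.Binary.Construct.Closure.Equivalence using (EqClosure)
open import Relation.Nullary using (Dec; ¬?)
open import Relation.Nullary.Decidable using (⌊_⌋; _×-dec_; _⊎-dec_)

-- Each face F has an
-- oriented boundary cycle, given as the (cyclic) list of arrows bdry F,
-- and a sign: pos F ≡ true means F ∈ Q₂⁺, pos F ≡ false means F ∈ Q₂⁻.

record FQuiver : Set where
  field
    nV nA nF : ℕ
    src tgt  : Fin nA → Fin nV
    bdry     : Fin nF → List (Fin nA)
    pos      : Fin nF → Bool

cycPairs : {A : Set} → List A → List (A × A)
cycPairs []       = []
cycPairs (x ∷ xs) = zip (x ∷ xs) (xs ++ (x ∷ []))

occIn : {n : ℕ} → Fin n → List (Fin n) → ℕ
occIn a xs = length (filter (a ≟_) xs)

module _ (Q : FQuiver) where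
  open FQuiver Q

  occ : Fin nA → ℕ
  occ α = sum (map (λ F → occIn α (bdry F)) (allFin nF))

  IsBoundaryArrow : Fin nA → Set
  IsBoundaryArrow α = occ α ≡ 1

  IsInternalArrow : Fin nA → Set
  IsInternalArrow α =
    occ α ≡ 2 × Σ (Fin nF) λ F⁺ → Σ (Fin nF) λ F⁻ →
      α ∈ bdry F⁺ × pos F⁺ ≡ true × α ∈ bdry F⁻ × pos F⁻ ≡ false

  SubpathOfFace : Fin nA → Fin nA → Set
  SubpathOfFace α β = Σ (Fin nF) λ F → (α , β) ∈ cycPairs (bdry F)

  Incident : Fin nV → Fin nA → Set
  Incident i α = src α ≡ i ⊎ tgt α ≡ i

  IncEdge : Fin nV → Fin nA → Fin nA → Set
  IncEdge i α β = tgt α ≡ i × src β ≡ i × SubpathOfFace α β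

  record IsDimerQuiver : Set where
    field
      faceCycle    : ∀ F → bdry F ≢ [] ×
                       All (λ p → tgt (proj₁ p) ≡ src (proj₂ p)) (cycPairs (bdry F))
      noLoops      : ∀ α → src α ≢ tgt α
      arrowFaces   : ∀ α → IsBoundaryArrow α ⊎ IsInternalArrow α
      incNonEmpty  : ∀ i → Σ (Fin nA) (Incident i)
      incConnected : ∀ i α β → Incident i α → Incident i β →
                       EqClosure (IncEdge i) α β

  -- Convention: faces in Q₂⁺ are oriented
  -- anticlockwise, faces in Q₂⁻ clockwise.  Moving along the boundary
  -- arrow α from vertex a to vertex b is an anticlockwise step if
  -- α : a → b lies in a positive face or α : b → a lies in a negative face.
  AnticlockwiseStep : Fin nA → Fin nV → Fin nV → Set
  AnticlockwiseStep α a b = Σ (Fin nF) λ F → α ∈ bdry F ×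
    ((src α ≡ a × tgt α ≡ b × pos F ≡ true) ⊎ (src α ≡ b × tgt α ≡ a × pos F ≡ false))

  ClockwiseStep : Fin nA → Fin nV → Fin nV → Set
  ClockwiseStep α a b = Σ (Fin nF) λ F → α ∈ bdry F ×
    ((src α ≡ a × tgt α ≡ b × pos F ≡ false) ⊎ (src α ≡ b × tgt α ≡ a × pos F ≡ true))

  -- I = {i₁,…,i_s}, J = {j₁,…,j_s}; i_m is  ia (m-1),  j_m is  ja (m-1),
  -- v_m is  v m,  w_m is  w m  (m : Fin (suc s)).
  record LabelledBoundaryPair (s : ℕ) (v w : Fin (suc s) → Fin nV)
                              (ia ja : Fin s → Fin nA) : Set where
    field
      iInjective     : ∀ k l → ia k ≡ ia l → k ≡ l
      jInjective     : ∀ k l → ja k ≡ ja l → k ≡ l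
      disjoint       : ∀ k l → ia k ≢ ja l
      iBoundary      : ∀ k → IsBoundaryArrow (ia k)
      jBoundary      : ∀ k → IsBoundaryArrow (ja k)
      iClockwise     : ∀ k → ClockwiseStep (ia k) (v (inject₁ k)) (v (fsuc k))
      jAnticlockwise : ∀ k → AnticlockwiseStep (ja k) (w (inject₁ k)) (w (fsuc k))
      vwDistinct     : ∀ (m : Fin (suc s)) → 1 ≤ toℕ m → toℕ m < s → v m ≢ w m

  module Rho (s : ℕ) (v w : Fin (suc s) → Fin nV) (ia ja : Fin s → Fin nA) where

    Parallel : Fin s → Set
    Parallel k =
      (src (ia k) ≡ v (inject₁ k) × tgt (ia k) ≡ v (fsuc k) ×
       src (ja k) ≡ w (inject₁ k) × tgt (ja k) ≡ w (fsuc k))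
      ⊎
      (src (ia k) ≡ v (fsuc k) × tgt (ia k) ≡ v (inject₁ k) ×
       src (ja k) ≡ w (fsuc k) × tgt (ja k) ≡ w (inject₁ k))

    parallel? : ∀ k → Dec (Parallel k)
    parallel? k =
      (src (ia k) ≟ v (inject₁ k) ×-dec tgt (ia k) ≟ v (fsuc k) ×-dec
       src (ja k) ≟ w (inject₁ k) ×-dec tgt (ja k) ≟ w (fsuc k))
      ⊎-dec
      (src (ia k) ≟ v (fsuc k) ×-dec tgt (ia k) ≟ v (inject₁ k) ×-dec
       src (ja k) ≟ w (fsuc k) ×-dec tgt (ja k) ≟ w (inject₁ k))

    NP : List (Fin s)
    NP = filter (λ k → ¬? (parallel? k)) (allFin s)

    t : ℕ
    t = length NP

    -- does some face of Q₂⁺ contain α  (for a boundary arrow: the sign of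
    -- the unique face containing α)
    inPosFace : Fin nA → Bool
    inPosFace α = any (λ F → ⌊ any? (α ≟_) (bdry F) ⌋ ∧ pos F) (allFin nF)

    -- ρ(Q): arrows Fin (nA + t), the new arrow  nA ↑ʳ r  being ρ(j_m) for
    -- m-1 = lookup NP r; faces Fin (nF + t), the new face  nF ↑ʳ r  having
    -- boundary the 2-cycle j_m ρ(j_m) and sign opposite to the face of j_m.
    rhoQ : FQuiver
    rhoQ = record
      { nV   = nV
      ; nA   = nA + t
      ; nF   = nF + t
      ; src  = λ x → srcρ (splitAt nA x)
      ; tgt  = λ x → tgtρ (splitAt nA x)
      ; bdry = λ f → bdryρ (splitAt nF f)
      ; pos  = λ f → posρ (splitAt nF f)
      }
      where
        srcρ : Fin nA ⊎ Fin t → Fin nV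
        srcρ (inj₁ a) = src a
        srcρ (inj₂ r) = tgt (ja (lookup NP r))
        tgtρ : Fin nA ⊎ Fin t → Fin nV
        tgtρ (inj₁ a) = tgt a
        tgtρ (inj₂ r) = src (ja (lookup NP r))
        bdryρ : Fin nF ⊎ Fin t → List (Fin (nA + t))
        bdryρ (inj₁ F) = map (_↑ˡ t) (bdry F)
        bdryρ (inj₂ r) = (ja (lookup NP r) ↑ˡ t) ∷ (nA ↑ʳ r) ∷ []
        posρ : Fin nF ⊎ Fin t → Bool
        posρ (inj₁ F) = pos F
        posρ (inj₂ r) = not (inPosFace (ja (lookup NP r)))

ρ : (Q : FQuiver) (s : ℕ) (v w : Fin (suc s) → Fin (FQuiver.nV Q))
    (ia ja : Fin s → Fin (FQuiver.nA Q)) → FQuiver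
ρ Q s v w ia ja = Rho.rhoQ Q s v w ia ja

-- Only one property of the pairs (i_m , j_m) matters: the arrows j_m with
-- i_m , j_m not parallel are distinct boundary arrows.  Each such j_m lies on
-- exactly one face F of Q; in ρ(Q) it also lies on the new 2-cycle, whose sign
-- is opposite to that of F, so j_m becomes an internal arrow, while the new
-- arrow ρ(j_m) is a boundary arrow.  The endpoints of ρ(j_m) are those of j_m,
-- and at each of them ρ(j_m) is joined to j_m in the incidence graph by the
-- 2-cycle, so connectivity of the incidence graphs is inherited from Q.

module Submission where

open import Data.Bool using (Bool; true; false; not; T; _∧_)
open import Data.Bool.Properties using (T-∧; T-≡)
open import Data.Nat using (ℕ; zero; suc; _+_; _<_)
import Data.Nat.Properties as ℕ
open import Data.Fin using (Fin; _↑ˡ_; _↑ʳ_; splitAt) renaming (zero to fzero; suc to fsuc)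
open import Data.Fin.Properties
  using (_≟_; suc-injective; splitAt-↑ˡ; splitAt-↑ʳ; splitAt⁻¹-↑ˡ; splitAt⁻¹-↑ʳ; ↑ˡ-injective; ↑ʳ-injective)
import Data.Fin.Properties as Fin
open import Data.List using (List; []; _∷_; _++_; zip; map; lookup; allFin)
open import Data.List.Properties using (map-tabulate; map-cong; map-++; zip-map)
open import Data.Nat.ListAction using (sum)
open import Data.List.Membership.Propositional using (_∈_; lose)
open import Data.List.Membership.Propositional.Properties using (∈-map⁺; ∈-lookup; ∈-allFin)
open import Data.List.Relation.Unary.Any using (here; there; any?; satisfied)
open import Data.List.Relation.Unary.Any.Properties using (any⁺; any⁻)
open import Data.List.Relation.Unary.All using (All; _∷_; [])
import Data.List.Relation.Unary.All as All
import Data.List.Relation.Unary.All.Properties as All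
open import Data.List.Relation.Unary.Unique.Propositional using (Unique)
open import Data.List.Relation.Unary.AllPairs using (_∷_)
open import Data.List.Relation.Unary.Unique.Propositional.Properties using (allFin⁺; filter⁺)
open import Data.Product using (Σ; ∃; _×_; _,_; proj₁; proj₂)
import Data.Product as Product
open import Data.Sum using (_⊎_; inj₁; inj₂)
open import Data.Empty using (⊥-elim)
open import Function using (_∘_; id; Equivalence)
open import Function.Definitions using (Injective)
open import Relation.Binary.PropositionalEquality
open import Relation.Nullary using (Dec; yes; no; ¬?; contradiction)
open import Relation.Nullary.Decidable using (⌊_⌋; toWitness; fromWitness)
open import Relation.Binary.Construct.Closure.Equivalence using (EqClosure)
import Relation.Binary.Construct.Closure.Equivalence as EqClosure
open import Relation.Binary.Construct.Closure.ReflexiveTransitive using (ε; _◅_)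
open import Relation.Binary.Construct.Closure.Symmetric using (fwd; bwd)
open import Defs

-- Chosen so that occ Q a is by definition ∑ λ F → occIn a (bdry F).
∑ : ∀ {n} → (Fin n → ℕ) → ℕ
∑ {n} g = sum (map g (allFin n))

∑-suc : ∀ {n} (g : Fin (suc n) → ℕ) → ∑ g ≡ g fzero + ∑ (g ∘ fsuc)
∑-suc g = trans (cong sum (map-tabulate id g))
                (sym (cong (λ xs → g fzero + sum xs) (map-tabulate id (g ∘ fsuc))))

∑-cong : ∀ {n} {f g : Fin n → ℕ} → (∀ i → f i ≡ g i) → ∑ f ≡ ∑ g
∑-cong {n} f≗g = cong sum (map-cong f≗g (allFin n))

∑-zero : ∀ n → ∑ {n} (λ _ → 0) ≡ 0
∑-zero zero    = refl
∑-zero (suc n) = trans (∑-suc {n} (λ _ → 0)) (∑-zero n)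

∑-↑ : ∀ m {n} (g : Fin (m + n) → ℕ) → ∑ g ≡ ∑ (g ∘ (_↑ˡ n)) + ∑ (g ∘ (m ↑ʳ_))
∑-↑ zero    g = refl
∑-↑ (suc m) {n} g = begin
  ∑ g                                                        ≡⟨ ∑-suc g ⟩
  g fzero + ∑ (g ∘ fsuc)                                     ≡⟨ cong (g fzero +_) (∑-↑ m (g ∘ fsuc)) ⟩
  g fzero + (∑ (g ∘ fsuc ∘ (_↑ˡ n)) + ∑ (g ∘ (suc m ↑ʳ_)))   ≡⟨ ℕ.+-assoc (g fzero) _ _ ⟨
  g fzero + ∑ (g ∘ fsuc ∘ (_↑ˡ n)) + ∑ (g ∘ (suc m ↑ʳ_))     ≡⟨ cong (_+ ∑ (g ∘ (suc m ↑ʳ_))) (∑-suc (g ∘ (_↑ˡ n))) ⟨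
  ∑ (g ∘ (_↑ˡ n)) + ∑ (g ∘ (suc m ↑ʳ_))                      ∎
  where open ≡-Reasoning

∑≢0⇒∃≢0 : ∀ {n} (g : Fin n → ℕ) → ∑ g ≢ 0 → ∃ λ i → g i ≢ 0
∑≢0⇒∃≢0 {zero}  g ∑g≢0 = contradiction refl ∑g≢0
∑≢0⇒∃≢0 {suc n} g ∑g≢0 with g fzero ℕ.≟ 0
... | no g0≢0 = fzero , g0≢0
... | yes g0≡0 =
  Product.map fsuc id (∑≢0⇒∃≢0 (g ∘ fsuc) λ e → ∑g≢0 (trans (∑-suc g) (cong₂ _+_ g0≡0 e)))

δ : ∀ {n} → Fin n → Fin n → ℕ
δ a x = occIn a (x ∷ [])

δ-refl : ∀ {n} (a : Fin n) → δ a a ≡ 1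
δ-refl a with a ≟ a
... | yes _   = refl
... | no a≢a = contradiction refl a≢a

δ-≢ : ∀ {n} {a x : Fin n} → a ≢ x → δ a x ≡ 0
δ-≢ {a = a} {x} a≢x with a ≟ x
... | yes a≡x = contradiction a≡x a≢x
... | no _    = refl

δ-injective : ∀ {m n} {g : Fin m → Fin n} → Injective _≡_ _≡_ g →
              ∀ a x → δ (g a) (g x) ≡ δ a x
δ-injective {g = g} g-inj a x = by-cases (a ≟ x)
  where
  by-cases : Dec (a ≡ x) → δ (g a) (g x) ≡ δ a x
  by-cases (yes refl) = trans (δ-refl (g a)) (sym (δ-refl a))
  by-cases (no a≢x)   = trans (δ-≢ (a≢x ∘ g-inj)) (sym (δ-≢ a≢x))

∑-δ : ∀ {n} (r : Fin n) → ∑ (δ r) ≡ 1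
∑-δ {suc n} z@fzero = begin
  ∑ (δ z)                  ≡⟨ ∑-suc (δ z) ⟩
  δ z z + ∑ (δ z ∘ fsuc)   ≡⟨ cong₂ _+_ (δ-refl z) (∑-cong λ i → δ-≢ {a = z} {x = fsuc i} λ ()) ⟩
  1 + ∑ {n} (λ _ → 0)      ≡⟨ cong suc (∑-zero n) ⟩
  1                        ∎
  where open ≡-Reasoning
∑-δ {suc n} (fsuc r) = begin
  ∑ (δ (fsuc r))                             ≡⟨ ∑-suc (δ (fsuc r)) ⟩
  δ (fsuc r) fzero + ∑ (δ (fsuc r) ∘ fsuc)   ≡⟨ cong₂ _+_ (δ-≢ {a = fsuc r} {x = fzero} λ ())
                                                          (∑-cong (δ-injective suc-injective r)) ⟩
  0 + ∑ (δ r)                                ≡⟨ ∑-δ r ⟩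
  1                                          ∎
  where open ≡-Reasoning

∑-δ-image : ∀ {m n} {g : Fin m → Fin n} → Injective _≡_ _≡_ g →
            ∀ r → ∑ (λ r′ → δ (g r) (g r′)) ≡ 1
∑-δ-image g-inj r = trans (∑-cong (δ-injective g-inj r)) (∑-δ r)

∑-δ-∉image : ∀ {m n} (g : Fin m → Fin n) {a} → (∀ r → g r ≢ a) → ∑ (λ r → δ a (g r)) ≡ 0
∑-δ-∉image {m} g a∉g = trans (∑-cong λ r → δ-≢ (a∉g r ∘ sym)) (∑-zero m)

occIn-∷ : ∀ {n} (a x : Fin n) xs → occIn a (x ∷ xs) ≡ δ a x + occIn a xs
occIn-∷ a x xs with a ≟ x
... | yes _ = refl
... | no _  = refl

occIn-pair : ∀ {n} (a x y : Fin n) → occIn a (x ∷ y ∷ []) ≡ δ a x + δ a y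
occIn-pair a x y = occIn-∷ a x (y ∷ [])

occIn-map-injective : ∀ {m n} {g : Fin m → Fin n} → Injective _≡_ _≡_ g →
                      ∀ a xs → occIn (g a) (map g xs) ≡ occIn a xs
occIn-map-injective g-inj a []       = refl
occIn-map-injective {g = g} g-inj a (x ∷ xs) =
  trans (occIn-∷ (g a) (g x) (map g xs))
        (trans (cong₂ _+_ (δ-injective g-inj a x) (occIn-map-injective g-inj a xs))
               (sym (occIn-∷ a x xs)))

occIn-map-∉image : ∀ {m n} (g : Fin m → Fin n) {b} → (∀ x → g x ≢ b) →
                   ∀ xs → occIn b (map g xs) ≡ 0
occIn-map-∉image g b∉g []       = refl
occIn-map-∉image g {b} b∉g (x ∷ xs) =
  trans (occIn-∷ b (g x) (map g xs))
        (cong₂ _+_ (δ-≢ (b∉g x ∘ sym)) (occIn-map-∉image g b∉g xs))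

occIn≢0⇒∈ : ∀ {n} (a : Fin n) xs → occIn a xs ≢ 0 → a ∈ xs
occIn≢0⇒∈ a []       ne = contradiction refl ne
occIn≢0⇒∈ a (x ∷ xs) ne with a ≟ x
... | yes a≡x = here a≡x
... | no _    = there (occIn≢0⇒∈ a xs ne)

cycPairs-map : ∀ {A B : Set} (f : A → B) xs →
               cycPairs (map f xs) ≡ map (Product.map f f) (cycPairs xs)
cycPairs-map f []       = refl
cycPairs-map f (x ∷ xs) =
  trans (cong (zip (f x ∷ map f xs)) (sym (map-++ f xs (x ∷ []))))
        (zip-map f f (x ∷ xs) (xs ++ x ∷ []))

∈-cycPairs-map : ∀ {A B : Set} (f : A → B) {a b : A} xs → (a , b) ∈ cycPairs xs →
                 (f a , f b) ∈ cycPairs (map f xs)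
∈-cycPairs-map f xs ab∈ = subst (_ ∈_) (sym (cycPairs-map f xs)) (∈-map⁺ (Product.map f f) ab∈)

map-≢[] : ∀ {A B : Set} (f : A → B) {xs : List A} → xs ≢ [] → map f xs ≢ []
map-≢[] f {[]}    xs≢[] _ = xs≢[] refl
map-≢[] f {_ ∷ _} _      ()

lookup-injective : ∀ {A : Set} {xs : List A} → Unique xs → Injective _≡_ _≡_ (lookup xs)
lookup-injective {xs = _ ∷ _} _          {fzero}  {fzero}  _ = refl
lookup-injective {xs = _ ∷ _} (x∉ ∷ _)   {fzero}  {fsuc j} e = contradiction e (All.lookup x∉ (∈-lookup j))
lookup-injective {xs = _ ∷ _} (x∉ ∷ _)   {fsuc i} {fzero}  e = contradiction (sym e) (All.lookup x∉ (∈-lookup i))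
lookup-injective {xs = _ ∷ _} (_ ∷ uniq) {fsuc i} {fsuc j} e = cong fsuc (lookup-injective uniq e)

↑ˡ≢↑ʳ : ∀ {m n} (a : Fin m) (r : Fin n) → a ↑ˡ n ≢ m ↑ʳ r
↑ˡ≢↑ʳ {m} {n} a r eq with trans (sym (splitAt-↑ˡ m a n)) (trans (cong (splitAt m) eq) (splitAt-↑ʳ m n r))
... | ()

data ↑-View (m n : ℕ) : Fin (m + n) → Set where
  old : (a : Fin m) → ↑-View m n (a ↑ˡ n)
  new : (r : Fin n) → ↑-View m n (m ↑ʳ r)

↑-view : ∀ m {n} (x : Fin (m + n)) → ↑-View m n x
↑-view m x with splitAt m x in eq
... | inj₁ a = subst (↑-View m _) (splitAt⁻¹-↑ˡ eq) (old a)
... | inj₂ r = subst (↑-View m _) (splitAt⁻¹-↑ʳ eq) (new r)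

module _ (Q : FQuiver) where
  open FQuiver Q

  FaceIsCycle : Fin nF → Set
  FaceIsCycle F = bdry F ≢ [] × All (λ p → tgt (proj₁ p) ≡ src (proj₂ p)) (cycPairs (bdry F))

  occ≢0⇒∈face : ∀ a → occ Q a ≢ 0 → Σ (Fin nF) λ F → a ∈ bdry F
  occ≢0⇒∈face a occ≢0 =
    let F , a∈F = ∑≢0⇒∃≢0 (λ F → occIn a (bdry F)) occ≢0 in F , occIn≢0⇒∈ a (bdry F) a∈F

  -- What the proof uses about ρ(Q): old arrows and faces are the a ↑ˡ t and F ↑ˡ t,
  -- the new arrow nA ↑ʳ r plays ρ(j r) and the new face nF ↑ʳ r its 2-cycle.
  record TwoCycleExtension {t : ℕ} (j : Fin t → Fin nA) : Set where
    field
      src′ tgt′ : Fin (nA + t) → Fin nV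
      bdry′     : Fin (nF + t) → List (Fin (nA + t))
      pos′      : Fin (nF + t) → Bool
      src′-↑ˡ   : ∀ a → src′ (a ↑ˡ t) ≡ src a
      tgt′-↑ˡ   : ∀ a → tgt′ (a ↑ˡ t) ≡ tgt a
      src′-↑ʳ   : ∀ r → src′ (nA ↑ʳ r) ≡ tgt (j r)
      tgt′-↑ʳ   : ∀ r → tgt′ (nA ↑ʳ r) ≡ src (j r)
      bdry′-↑ˡ  : ∀ F → bdry′ (F ↑ˡ t) ≡ map (_↑ˡ t) (bdry F)
      bdry′-↑ʳ  : ∀ r → bdry′ (nF ↑ʳ r) ≡ (j r ↑ˡ t) ∷ (nA ↑ʳ r) ∷ []
      pos′-↑ˡ   : ∀ F → pos′ (F ↑ˡ t) ≡ pos F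
      pos′-↑ʳ   : ∀ r → Σ (Fin nF) λ F → j r ∈ bdry F × pos′ (nF ↑ʳ r) ≡ not (pos F)

    quiver : FQuiver
    quiver = record
      { nV = nV ; nA = nA + t ; nF = nF + t
      ; src = src′ ; tgt = tgt′ ; bdry = bdry′ ; pos = pos′ }

module TwoCycleExtensionProperties {Q : FQuiver} {t : ℕ} {j : Fin t → Fin (FQuiver.nA Q)}
                                   (E : TwoCycleExtension Q j) where
  open FQuiver Q
  open TwoCycleExtension E
  private
    Q′ : FQuiver
    Q′ = quiver
    module Q′ = FQuiver Q′

  faceIsCycle : (∀ F → FaceIsCycle Q F) → ∀ F → FaceIsCycle Q′ F
  faceIsCycle cycle F with ↑-view nF F
  ... | old F₀ rewrite bdry′-↑ˡ F₀ =
    map-≢[] (_↑ˡ t) (proj₁ (cycle F₀)) ,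
    subst (All _) (sym (cycPairs-map (_↑ˡ t) (bdry F₀)))
          (All.map⁺ (All.map (λ {p} e → trans (tgt′-↑ˡ (proj₁ p)) (trans e (sym (src′-↑ˡ (proj₂ p)))))
                             (proj₂ (cycle F₀))))
  ... | new r rewrite bdry′-↑ʳ r =
    (λ ()) , trans (tgt′-↑ˡ (j r)) (sym (src′-↑ʳ r)) ∷ trans (tgt′-↑ʳ r) (sym (src′-↑ˡ (j r))) ∷ []

  noLoops : (∀ a → src a ≢ tgt a) → ∀ α → Q′.src α ≢ Q′.tgt α
  noLoops loopless α with ↑-view nA α
  ... | old a = λ e → loopless a (trans (sym (src′-↑ˡ a)) (trans e (tgt′-↑ˡ a)))
  ... | new r = λ e → loopless (j r) (trans (sym (tgt′-↑ʳ r)) (trans (sym e) (src′-↑ʳ r)))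

  occ-old : ∀ a → occ Q′ (a ↑ˡ t) ≡ occ Q a + ∑ (λ r → δ a (j r))
  occ-old a = trans (∑-↑ nF _) (cong₂ _+_
    (∑-cong λ F → trans (cong (occIn (a ↑ˡ t)) (bdry′-↑ˡ F))
                        (occIn-map-injective (↑ˡ-injective t _ _) a (bdry F)))
    (∑-cong λ r → begin
      occIn (a ↑ˡ t) (bdry′ (nF ↑ʳ r))               ≡⟨ cong (occIn (a ↑ˡ t)) (bdry′-↑ʳ r) ⟩
      occIn (a ↑ˡ t) ((j r ↑ˡ t) ∷ (nA ↑ʳ r) ∷ [])   ≡⟨ occIn-pair (a ↑ˡ t) (j r ↑ˡ t) (nA ↑ʳ r) ⟩
      δ (a ↑ˡ t) (j r ↑ˡ t) + δ (a ↑ˡ t) (nA ↑ʳ r)   ≡⟨ cong₂ _+_ (δ-injective (↑ˡ-injective t _ _) a (j r))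
                                                                  (δ-≢ (↑ˡ≢↑ʳ a r)) ⟩
      δ a (j r) + 0                                  ≡⟨ ℕ.+-identityʳ _ ⟩
      δ a (j r)                                      ∎))
    where open ≡-Reasoning

  occ-new : ∀ r → occ Q′ (nA ↑ʳ r) ≡ 1
  occ-new r = trans (∑-↑ nF _) (cong₂ _+_
    (trans (∑-cong λ F → trans (cong (occIn (nA ↑ʳ r)) (bdry′-↑ˡ F))
                               (occIn-map-∉image (_↑ˡ t) (λ a → ↑ˡ≢↑ʳ a r) (bdry F)))
           (∑-zero nF))
    (trans (∑-cong λ r′ → begin
      occIn (nA ↑ʳ r) (bdry′ (nF ↑ʳ r′))                ≡⟨ cong (occIn (nA ↑ʳ r)) (bdry′-↑ʳ r′) ⟩
      occIn (nA ↑ʳ r) ((j r′ ↑ˡ t) ∷ (nA ↑ʳ r′) ∷ [])   ≡⟨ occIn-pair (nA ↑ʳ r) (j r′ ↑ˡ t) (nA ↑ʳ r′) ⟩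
      δ (nA ↑ʳ r) (j r′ ↑ˡ t) + δ (nA ↑ʳ r) (nA ↑ʳ r′)  ≡⟨ cong₂ _+_ (δ-≢ (↑ˡ≢↑ʳ (j r′) r ∘ sym))
                                                                     (δ-injective (↑ʳ-injective nA _ _) r r′) ⟩
      δ r r′                                            ∎)
      (∑-δ r)))
    where open ≡-Reasoning

  ∈-old : ∀ {a F} → a ∈ bdry F → (a ↑ˡ t) ∈ bdry′ (F ↑ˡ t)
  ∈-old {F = F} a∈F = subst (_ ∈_) (sym (bdry′-↑ˡ F)) (∈-map⁺ (_↑ˡ t) a∈F)

  j∈new : ∀ r → (j r ↑ˡ t) ∈ bdry′ (nF ↑ʳ r)
  j∈new r = subst (_ ∈_) (sym (bdry′-↑ʳ r)) (here refl)

  internal-old : ∀ {a} → (∀ r → j r ≢ a) → IsInternalArrow Q a → IsInternalArrow Q′ (a ↑ˡ t)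
  internal-old {a} a∉j (occ≡2 , F⁺ , F⁻ , a∈F⁺ , F⁺-pos , a∈F⁻ , F⁻-neg) =
    trans (occ-old a) (cong₂ _+_ occ≡2 (∑-δ-∉image j a∉j)) ,
    F⁺ ↑ˡ t , F⁻ ↑ˡ t , ∈-old a∈F⁺ , trans (pos′-↑ˡ F⁺) F⁺-pos , ∈-old a∈F⁻ , trans (pos′-↑ˡ F⁻) F⁻-neg

  internal-j : Injective _≡_ _≡_ j → (∀ r → IsBoundaryArrow Q (j r)) →
               ∀ r → IsInternalArrow Q′ (j r ↑ˡ t)
  internal-j j-inj j-bdry r =
    trans (occ-old (j r)) (cong₂ _+_ (j-bdry r) (∑-δ-image j-inj r)) , faces (pos′-↑ʳ r)
    where
    faces : (Σ (Fin nF) λ F → j r ∈ bdry F × pos′ (nF ↑ʳ r) ≡ not (pos F)) →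
            Σ (Fin (nF + t)) λ F⁺ → Σ (Fin (nF + t)) λ F⁻ →
              (j r ↑ˡ t) ∈ bdry′ F⁺ × pos′ F⁺ ≡ true × (j r ↑ˡ t) ∈ bdry′ F⁻ × pos′ F⁻ ≡ false
    faces (F , jr∈F , sign) with pos F in F-sign
    ... | true  = F ↑ˡ t , nF ↑ʳ r , ∈-old jr∈F , trans (pos′-↑ˡ F) F-sign , j∈new r , sign
    ... | false = nF ↑ʳ r , F ↑ˡ t , j∈new r , sign , ∈-old jr∈F , trans (pos′-↑ˡ F) F-sign

  arrowFaces : Injective _≡_ _≡_ j → (∀ r → IsBoundaryArrow Q (j r)) →
               (∀ a → IsBoundaryArrow Q a ⊎ IsInternalArrow Q a) →
               ∀ α → IsBoundaryArrow Q′ α ⊎ IsInternalArrow Q′ α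
  arrowFaces j-inj j-bdry faces α with ↑-view nA α
  ... | new r = inj₁ (occ-new r)
  ... | old a with faces a | Fin.any? (λ r → j r ≟ a)
  ... | inj₁ _        | yes (r , refl) = inj₂ (internal-j j-inj j-bdry r)
  ... | inj₁ boundary | no a∉j         =
    inj₁ (trans (occ-old a) (cong₂ _+_ boundary (∑-δ-∉image j λ r e → a∉j (r , e))))
  ... | inj₂ internal | _              = inj₂ (internal-old a∉j internal)
    where
    a∉j : ∀ r → j r ≢ a
    a∉j r refl with () ← trans (sym (j-bdry r)) (proj₁ internal)

  incident-old : ∀ {i a} → Incident Q i a → Incident Q′ i (a ↑ˡ t)
  incident-old {a = a} (inj₁ e) = inj₁ (trans (src′-↑ˡ a) e)
  incident-old {a = a} (inj₂ e) = inj₂ (trans (tgt′-↑ˡ a) e)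

  incident-old⁻ : ∀ {i a} → Incident Q′ i (a ↑ˡ t) → Incident Q i a
  incident-old⁻ {a = a} (inj₁ e) = inj₁ (trans (sym (src′-↑ˡ a)) e)
  incident-old⁻ {a = a} (inj₂ e) = inj₂ (trans (sym (tgt′-↑ˡ a)) e)

  incNonEmpty : (∀ i → Σ (Fin nA) (Incident Q i)) → ∀ i → Σ (Fin (nA + t)) (Incident Q′ i)
  incNonEmpty nonEmpty i = let a , a-inc = nonEmpty i in a ↑ˡ t , incident-old a-inc

  incEdge-old : ∀ {i a b} → IncEdge Q i a b → IncEdge Q′ i (a ↑ˡ t) (b ↑ˡ t)
  incEdge-old {a = a} {b} (a→i , i→b , F , ab∈F) =
    trans (tgt′-↑ˡ a) a→i , trans (src′-↑ˡ b) i→b , F ↑ˡ t ,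
    subst (λ xs → (a ↑ˡ t , b ↑ˡ t) ∈ cycPairs xs) (sym (bdry′-↑ˡ F)) (∈-cycPairs-map (_↑ˡ t) (bdry F) ab∈F)

  -- The new face links nA ↑ʳ r to j r ↑ˡ t at both of their common endpoints.
  linkToOld : ∀ {i α} → Incident Q′ i α →
              Σ (Fin nA) λ a → Incident Q i a × EqClosure (IncEdge Q′ i) α (a ↑ˡ t)
  linkToOld {α = α} α-inc with ↑-view nA α
  linkToOld α-inc        | old a = a , incident-old⁻ α-inc , ε
  linkToOld (inj₁ r→i)   | new r =
    j r , inj₂ (trans (sym (src′-↑ʳ r)) r→i) ,
    bwd (trans (tgt′-↑ˡ (j r)) (trans (sym (src′-↑ʳ r)) r→i) , r→i , nF ↑ʳ r ,
         subst (λ xs → (j r ↑ˡ t , nA ↑ʳ r) ∈ cycPairs xs) (sym (bdry′-↑ʳ r)) (here refl)) ◅ ε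
  linkToOld (inj₂ i→r)   | new r =
    j r , inj₁ (trans (sym (tgt′-↑ʳ r)) i→r) ,
    fwd (i→r , trans (src′-↑ˡ (j r)) (trans (sym (tgt′-↑ʳ r)) i→r) , nF ↑ʳ r ,
         subst (λ xs → (nA ↑ʳ r , j r ↑ˡ t) ∈ cycPairs xs) (sym (bdry′-↑ʳ r)) (there (here refl))) ◅ ε

  incConnected : (∀ i a b → Incident Q i a → Incident Q i b → EqClosure (IncEdge Q i) a b) →
                 ∀ i α β → Incident Q′ i α → Incident Q′ i β → EqClosure (IncEdge Q′ i) α β
  incConnected connected i α β α-inc β-inc =
    let a , a-inc , α~a = linkToOld α-inc
        b , b-inc , β~b = linkToOld β-inc
    in EqClosure.transitive (IncEdge Q′ i) α~a
         (EqClosure.transitive (IncEdge Q′ i)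
           (EqClosure.gmap (_↑ˡ t) incEdge-old (connected i a b a-inc b-inc))
           (EqClosure.symmetric (IncEdge Q′ i) β~b))

twoCycleExtension-isDimer : ∀ {Q t j} → IsDimerQuiver Q → Injective _≡_ _≡_ j →
                            (∀ r → IsBoundaryArrow Q (j r)) →
                            (E : TwoCycleExtension Q {t} j) →
                            IsDimerQuiver (TwoCycleExtension.quiver E)
twoCycleExtension-isDimer dimer j-inj j-bdry E = record
  { faceCycle    = faceIsCycle D.faceCycle
  ; noLoops      = noLoops D.noLoops
  ; arrowFaces   = arrowFaces j-inj j-bdry D.arrowFaces
  ; incNonEmpty  = incNonEmpty D.incNonEmpty
  ; incConnected = incConnected D.incConnected
  }
  where
  module D = IsDimerQuiver dimer
  open TwoCycleExtensionProperties E

module _ (Q : FQuiver) (s : ℕ) (v w : Fin (suc s) → Fin (FQuiver.nV Q))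
         (ia ja : Fin s → Fin (FQuiver.nA Q)) where
  open FQuiver Q
  open Rho Q s v w ia ja

  nonParallelJ : Fin t → Fin nA
  nonParallelJ r = ja (lookup NP r)

  nonParallelJ-injective : Injective _≡_ _≡_ ja → Injective _≡_ _≡_ nonParallelJ
  nonParallelJ-injective ja-inj =
    lookup-injective (filter⁺ (λ k → ¬? (parallel? k)) (allFin⁺ s)) ∘ ja-inj

  inPosFace-sign : ∀ {a F₀} → a ∈ bdry F₀ → Σ (Fin nF) λ F → a ∈ bdry F × inPosFace a ≡ pos F
  inPosFace-sign {a} {F₀} a∈F₀ with inPosFace a in a-pos
  ... | true =
    let F , a∈F∧pos = satisfied (any⁻ _ (allFin nF) (Equivalence.from T-≡ a-pos))
        a∈F , F-pos = Equivalence.to T-∧ a∈F∧pos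
    in F , toWitness a∈F , sym (Equivalence.to T-≡ F-pos)
  ... | false with pos F₀ in F₀-sign
  ...   | false = F₀ , a∈F₀ , sym F₀-sign
  ...   | true  = ⊥-elim (subst T a-pos (any⁺ _ (lose (∈-allFin F₀) F₀-pos)))
    where
    F₀-pos : T (⌊ any? (a ≟_) (bdry F₀) ⌋ ∧ pos F₀)
    F₀-pos = Equivalence.from T-∧ (fromWitness a∈F₀ , Equivalence.from T-≡ F₀-sign)

  ρ-twoCycleExtension : (∀ k → IsBoundaryArrow Q (ja k)) → TwoCycleExtension Q nonParallelJ
  ρ-twoCycleExtension ja-bdry = record
    { src′ = ρQ.src ; tgt′ = ρQ.tgt ; bdry′ = ρQ.bdry ; pos′ = ρQ.pos
    ; src′-↑ˡ = src-↑ˡ ; tgt′-↑ˡ = tgt-↑ˡ ; src′-↑ʳ = src-↑ʳ ; tgt′-↑ʳ = tgt-↑ʳ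
    ; bdry′-↑ˡ = bdry-↑ˡ ; bdry′-↑ʳ = bdry-↑ʳ ; pos′-↑ˡ = pos-↑ˡ ; pos′-↑ʳ = pos-↑ʳ
    }
    where
    module ρQ = FQuiver rhoQ
    src-↑ˡ : ∀ a → ρQ.src (a ↑ˡ t) ≡ src a
    src-↑ˡ a rewrite splitAt-↑ˡ nA a t = refl
    tgt-↑ˡ : ∀ a → ρQ.tgt (a ↑ˡ t) ≡ tgt a
    tgt-↑ˡ a rewrite splitAt-↑ˡ nA a t = refl
    src-↑ʳ : ∀ r → ρQ.src (nA ↑ʳ r) ≡ tgt (nonParallelJ r)
    src-↑ʳ r rewrite splitAt-↑ʳ nA t r = refl
    tgt-↑ʳ : ∀ r → ρQ.tgt (nA ↑ʳ r) ≡ src (nonParallelJ r)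
    tgt-↑ʳ r rewrite splitAt-↑ʳ nA t r = refl
    bdry-↑ˡ : ∀ F → ρQ.bdry (F ↑ˡ t) ≡ map (_↑ˡ t) (bdry F)
    bdry-↑ˡ F rewrite splitAt-↑ˡ nF F t = refl
    bdry-↑ʳ : ∀ r → ρQ.bdry (nF ↑ʳ r) ≡ (nonParallelJ r ↑ˡ t) ∷ (nA ↑ʳ r) ∷ []
    bdry-↑ʳ r rewrite splitAt-↑ʳ nF t r = refl
    pos-↑ˡ : ∀ F → ρQ.pos (F ↑ˡ t) ≡ pos F
    pos-↑ˡ F rewrite splitAt-↑ˡ nF F t = refl
    pos-↑ʳ : ∀ r → Σ (Fin nF) λ F → nonParallelJ r ∈ bdry F × ρQ.pos (nF ↑ʳ r) ≡ not (pos F)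
    pos-↑ʳ r rewrite splitAt-↑ʳ nF t r =
      let F₀ , jr∈F₀ = occ≢0⇒∈face Q (nonParallelJ r) λ occ≡0 → ℕ.1+n≢0 (trans (sym (ja-bdry _)) occ≡0)
          F , jr∈F , sign = inPosFace-sign jr∈F₀
      in F , jr∈F , cong not sign

lemma4p3 : (Q : FQuiver) → IsDimerQuiver Q →
           (s : ℕ) → 0 < s →
           (v w : Fin (suc s) → Fin (FQuiver.nV Q)) →
           (ia ja : Fin s → Fin (FQuiver.nA Q)) →
           LabelledBoundaryPair Q s v w ia ja →
           IsDimerQuiver (ρ Q s v w ia ja)
lemma4p3 Q dimer s _ v w ia ja labelled =
  twoCycleExtension-isDimer dimer
    (nonParallelJ-injective Q s v w ia ja (jInjective _ _))
    (λ r → jBoundary _)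
    (ρ-twoCycleExtension Q s v w ia ja jBoundary)
  where open LabelledBoundaryPair labelled
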